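{- Let $E$ be a set of designs on the same base. Then $E^{\maltese}\subseteq E^{\perp\perp}$.
   Context: Ludics (Girard). Addresses are finite sequences of naturals. Actions: $(+,\xi,I)$, $(-,\xi,I)$ ($I$ finite set of naturals) and daimon $\maltese$ (positive); an action on $\xi.i$ is justified by an action of opposite polarity on $\xi$ with $i$ in its ramification. A chronicle on a base $\Gamma\vdash\Delta$ is a nonempty finite alternating sequence of actions, each proper action initial or justified by an earlier action (non-initial negative ones by the immediately preceding action), distinct addresses, $\maltese$ only last. A design is a prefix-closed set of pairwise coherent chronicles on a base with maximal chronicles ending positively (nonempty with common first action if the base is positive). Interaction of a closed cut-net: start from the positive design; $\maltese$ gives $\{\maltese\}$; $(+,\sigma,I)$ requires a chronicle starting $(-,\sigma,I)$ in the design cut on $\sigma$ (else failure) and continues on subdesigns above. $\mathfrak D\perp\mathfrak R$ iff the result is $\{\maltese\}$; $E^\perp$ the set of designs orthogonal to every element of $E$. A $\maltese$-shorten of a chronicle $\mathfrak c$ is $\mathfrak c$ or $\mathfrak c_1\maltese$ where $\mathfrak c=\mathfrak c_1\mathfrak c_2$ and $\mathfrak c_1$ ends with a negative action; $E^{\maltese}$ is the set of designs obtained from designs of $E$ by $\maltese$-shortening chronicles. -}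

module Defs where

open import Level using (Lift)
open import Data.Nat using (ℕ; _<_)
open import Data.List using (List; []; _∷_; _++_; _∷ʳ_; map)
open import Data.List.Membership.Propositional using (_∈_)
open import Data.List.Relation.Unary.Linked using (Linked)
open import Data.List.Relation.Unary.AllPairs using (AllPairs)
open import Data.List.Relation.Unary.Unique.Propositional using (Unique)
open import Data.Maybe using (Maybe; just; nothing)
open import Data.Product using (Σ; ∃; _×_; _,_)
open import Data.Sum using (_⊎_)
open import Data.Unit using (⊤)
open import Relation.Nullary using (¬_)
open import Relation.Binary.PropositionalEquality using (_≡_; _≢_)

Address : Set
Address = List ℕ

-- A ramification (finite set of naturals) is represented canonically by
-- a strictly increasing list; well-formed chronicles require this.
Ram : Set
Ram = List ℕ

data Pol : Set where
  pos neg : Pol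

data Action : Set where
  daimon : Action
  act    : Pol → Address → Ram → Action

pol : Action → Pol
pol daimon      = pos
pol (act p _ _) = p

opp : Pol → Pol
opp pos = neg
opp neg = pos

addrs : List Action → List Address
addrs []                = []
addrs (daimon ∷ as)     = addrs as
addrs (act _ ξ _ ∷ as)  = ξ ∷ addrs as

Chron : Set
Chron = List Action

_⊑_ : {A : Set} → List A → List A → Set
c ⊑ c' = ∃ λ r → c ++ r ≡ c'

record Base : Set where
  constructor _⊢_
  field
    Γ : Maybe Address
    Δ : List Address
open Base public

toListM : Maybe Address → List Address
toListM nothing  = []
toListM (just ξ) = ξ ∷ []

IsBase : Base → Set
IsBase β = AllPairs (λ a b → ¬ (a ⊑ b) × ¬ (b ⊑ a)) (toListM (Γ β) ++ Δ β)

basePol : Base → Pol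
basePol (nothing ⊢ _) = pos
basePol (just _  ⊢ _) = neg

Initial : Base → Pol → Address → Set
Initial β pos ξ = ξ ∈ Δ β
Initial β neg ξ = Γ β ≡ just ξ

-- justification of an action of polarity q on ξ by the earlier actions p;
-- non-initial negative actions are justified by the immediately preceding action
Justified : Pol → Address → Chron → Set
Justified pos ξ p = ∃ λ ζ → ∃ λ i → ∃ λ J →
  (ξ ≡ ζ ∷ʳ i) × (act neg ζ J ∈ p) × (i ∈ J)
Justified neg ξ p = ∃ λ ζ → ∃ λ i → ∃ λ J → ∃ λ p' →
  (p ≡ p' ∷ʳ act pos ζ J) × (ξ ≡ ζ ∷ʳ i) × (i ∈ J)

record IsChronicle (β : Base) (c : Chron) : Set where
  field
    nonempty    : c ≢ []
    firstPol    : ∀ a s → c ≡ a ∷ s → pol a ≡ basePol β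
    alternating : ∀ p a b s → c ≡ p ++ a ∷ b ∷ s → pol b ≡ opp (pol a)
    daimonLast  : ∀ p s → c ≡ p ++ daimon ∷ s → s ≡ []
    ramSorted   : ∀ p q ξ I s → c ≡ p ++ act q ξ I ∷ s → Linked _<_ I
    justified   : ∀ p q ξ I s → c ≡ p ++ act q ξ I ∷ s →
                  Initial β q ξ ⊎ Justified q ξ p
    distinct    : Unique (addrs c)

Des : Set₁
Des = Chron → Set

EndsPos : Chron → Set
EndsPos c = ∃ λ p → ∃ λ a → (c ≡ p ∷ʳ a) × (pol a ≡ pos)

EndsNeg : Chron → Set
EndsNeg c = ∃ λ p → ∃ λ ξ → ∃ λ I → c ≡ p ∷ʳ act neg ξ I

Coherent : Chron → Chron → Set
Coherent c c' = (c ⊑ c') ⊎ (c' ⊑ c) ⊎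
  (∃ λ p → ∃ λ ξ → ∃ λ I → ∃ λ r → ∃ λ ξ' → ∃ λ I' → ∃ λ r' →
     (c ≡ p ++ act neg ξ I ∷ r) × (c' ≡ p ++ act neg ξ' I' ∷ r') ×
     (act neg ξ I ≢ act neg ξ' I') ×
     (ξ ≢ ξ' → ∀ {a b} → a ∈ addrs r → b ∈ addrs r' → a ≢ b))

record IsDesign (β : Base) (D : Des) : Set where
  field
    chronicles  : ∀ c → D c → IsChronicle β c
    prefClosed  : ∀ c r → D (c ++ r) → c ≢ [] → D c
    coherent    : ∀ c c' → D c → D c' → Coherent c c'
    maximalPos  : ∀ c → D c → (∀ c' → D c' → c ⊑ c' → c' ≡ c) → EndsPos c
    posNonempty : Γ β ≡ nothing →
                  ∃ λ a → (∃ λ s → D (a ∷ s)) × (∀ c → D c → ∃ λ s → c ≡ a ∷ s)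

-- A handle (σ , R , c) records that design R may receive a negative
-- action on σ, continuing its chronicle c.  The current positive player
-- is a design D at chronicle c (c empty or ending negatively).

record Handle : Set₁ where
  constructor handle
  field
    place : Address
    des   : Des
    pre   : Chron

-- Conv H D c : the interaction starting with D to play after c, with
-- pending handles H, terminates on ✠ (i.e. its result is {✠}).
data Conv : List Handle → Des → Chron → Set₁ where
  dai  : ∀ {H D c} → D (c ∷ʳ daimon) → Conv H D c
  step : ∀ {H D c σ I R c' H₁ H₂} →
         D (c ∷ʳ act pos σ I) →
         H ≡ H₁ ++ handle σ R c' ∷ H₂ →
         R (c' ∷ʳ act neg σ I) →
         Conv (H₁ ++ H₂ ++ map (λ i → handle (σ ∷ʳ i) D (c ∷ʳ act pos σ I)) I)
              R (c' ∷ʳ act neg σ I) →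
         Conv H D c

-- Counter-designs of a base Γ ⊢ Δ: a design on ⊢ ξ if Γ = ξ, and a
-- design on λ ⊢ for each λ ∈ Δ (given as a function on addresses; only
-- its values on Δ matter).

LeftCounter : Maybe Address → Set₁
LeftCounter nothing  = Lift _ ⊤
LeftCounter (just _) = Des

record Counter (β : Base) : Set₁ where
  constructor counter
  field
    left   : LeftCounter (Γ β)
    rights : Address → Des
open Counter public

LeftIsDesign : (m : Maybe Address) → LeftCounter m → Set
LeftIsDesign nothing  _ = ⊤
LeftIsDesign (just ξ) L = IsDesign (nothing ⊢ (ξ ∷ [])) L

IsCounter : (β : Base) → Counter β → Set
IsCounter β R = LeftIsDesign (Γ β) (left R) ×
                (∀ l → l ∈ Δ β → IsDesign (just l ⊢ []) (rights R l))

initHandles : List Address → (Address → Des) → List Handle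
initHandles Δ Rs = map (λ l → handle l (Rs l) []) Δ

Orth : (β : Base) → Des → Counter β → Set₁
Orth (nothing ⊢ Δ) D R = Conv (initHandles Δ (rights R)) D []
Orth (just ξ  ⊢ Δ) D R = Conv (handle ξ D [] ∷ initHandles Δ (rights R)) (left R) []

Perp : (β : Base) → (Des → Set) → Counter β → Set₁
Perp β E R = IsCounter β R × (∀ D → E D → Orth β D R)

BiPerp : (β : Base) → (Des → Set) → Des → Set₁
BiPerp β E D = IsDesign β D × (∀ R → Perp β E R → Orth β D R)

IsShorten : Chron → Chron → Set
IsShorten c s = (s ≡ c) ⊎
  (∃ λ c₁ → ∃ λ c₂ → (c ≡ c₁ ++ c₂) × EndsNeg c₁ × (s ≡ c₁ ∷ʳ daimon))

-- E^✠ : designs on β obtained from a design of E by ✠-shortening its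
-- chronicles: every chronicle of D' comes from a ✠-shorten of a chronicle
-- of D, and every chronicle of D is represented by one of its ✠-shortens.
DaiShort : (β : Base) → (Des → Set) → Des → Set₁
DaiShort β E D' = IsDesign β D' × Σ Des λ D → E D ×
  (∀ c' → D' c' → ∃ λ c → ∃ λ s → D c × IsShorten c s × (c' ⊑ s)) ×
  (∀ c → D c → ∃ λ s → IsShorten c s × D' s)

module Submission where

-- Let D ∈ E and let D' be a ✠-shortening of D: every
-- chronicle of D has a ✠-shorten in D'.  We show that every converging
-- interaction of D against a counter-design R can be replayed with D' in
-- place of D, so D' ⊥ R whenever D ⊥ R; in particular D' ∈ E^⊥⊥.
--
-- At a position x reached by the replay, a ✠-shorten of x·a lying in D'
-- is x·a itself, x·a·✠, or x·✠ (`shortenAtReached`): a shorter one would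
-- put ✠ strictly below x, and in a design a ✠ ending a branch admits no
-- other continuation (`daimonEndsBranch`).  Hence when D plays a positive
-- action, D' plays it or plays ✠ and the interaction ends at once
-- (`followPositive`); and when D receives a negative action, so does D'
-- (`followNegative`).  These are then turned into a simulation
-- between interactions (`replay`), by induction on the derivation of
-- convergence, relating pending handles and current players of both runs.

open import Defs
open import Data.List using (List; []; _∷_; _++_; _∷ʳ_; map)
open import Data.List.Properties using (∷-injective; ∷ʳ-injectiveʳ; ++-assoc; ++-conicalˡ; ++-conicalʳ)
open import Data.List.Relation.Binary.Pointwise as Pointwise using (Pointwise; []; _∷_; ++⁺; map⁺)
open import Data.Product using (Σ; ∃; _×_; _,_; proj₂)
open import Data.Sum as Sum using (_⊎_; inj₁; inj₂)
open import Data.Maybe using (just; nothing)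
open import Data.Empty using (⊥; ⊥-elim)
open import Relation.Binary.Core using (REL)
open import Relation.Nullary using (¬_)
open import Relation.Binary.PropositionalEquality using (_≡_; _≢_; refl; sym; trans; cong; subst)

snoc≢[] : ∀ {A : Set} (xs : List A) x → xs ∷ʳ x ≢ []
snoc≢[] xs x eq with ++-conicalʳ xs (x ∷ []) eq
... | ()

prefixOfSnoc : ∀ {A : Set} (x : List A) a p r → x ∷ʳ a ≡ p ++ r →
               p ≡ x ∷ʳ a ⊎ p ≡ x ⊎ (∃ λ z → ∃ λ rest → x ≡ p ++ z ∷ rest)
prefixOfSnoc []      a []      r eq = inj₂ (inj₁ refl)
prefixOfSnoc (z ∷ x) a []      r eq = inj₂ (inj₂ (z , x , refl))
prefixOfSnoc []      a (y ∷ p) r eq with ∷-injective eq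
... | refl , eq' = inj₁ (cong (y ∷_) (++-conicalˡ p r (sym eq')))
prefixOfSnoc (z ∷ x) a (y ∷ p) r eq with ∷-injective eq
... | refl , eq' =
  Sum.map (cong (z ∷_))
          (Sum.map (cong (z ∷_)) (λ { (w , rest , e) → w , rest , cong (z ∷_) e }))
          (prefixOfSnoc x a p r eq')

endsNegLast : ∀ c a → EndsNeg (c ∷ʳ a) → pol a ≡ neg
endsNegLast c a (p , ξ , I , e) = cong pol (∷ʳ-injectiveʳ c p e)

positiveDivergenceIncoherent : ∀ d a b r r' → pol a ≡ pos → pol b ≡ pos → a ≢ b →
                               ¬ Coherent (d ++ a ∷ r) (d ++ b ∷ r')
positiveDivergenceIncoherent [] a b r r' _ _ a≢b (inj₁ (_ , refl)) = a≢b refl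
positiveDivergenceIncoherent [] a b r r' _ _ a≢b (inj₂ (inj₁ (_ , refl))) = a≢b refl
positiveDivergenceIncoherent [] a b r r' pa _ _
  (inj₂ (inj₂ ([] , ξ , I , _ , _ , _ , _ , refl , _))) with pa
... | ()
positiveDivergenceIncoherent [] a b r r' _ _ a≢b
  (inj₂ (inj₂ (y ∷ p , _ , _ , _ , _ , _ , _ , refl , refl , _))) = a≢b refl
positiveDivergenceIncoherent (x ∷ d) a b r r' pa pb a≢b (inj₁ (t , e)) =
  positiveDivergenceIncoherent d a b r r' pa pb a≢b (inj₁ (t , proj₂ (∷-injective e)))
positiveDivergenceIncoherent (x ∷ d) a b r r' pa pb a≢b (inj₂ (inj₁ (t , e))) =
  positiveDivergenceIncoherent d a b r r' pa pb a≢b (inj₂ (inj₁ (t , proj₂ (∷-injective e))))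
positiveDivergenceIncoherent (x ∷ d) a b r r' _ _ _
  (inj₂ (inj₂ ([] , _ , _ , _ , _ , _ , _ , refl , refl , ne , _))) = ne refl
positiveDivergenceIncoherent (x ∷ d) a b r r' pa pb a≢b
  (inj₂ (inj₂ (y ∷ p , ξ , I , s , ξ' , I' , s' , e , e' , ne , disj))) =
  positiveDivergenceIncoherent d a b r r' pa pb a≢b
    (inj₂ (inj₂ (p , ξ , I , s , ξ' , I' , s' , proj₂ (∷-injective e) , proj₂ (∷-injective e') , ne , disj)))

module DesignFacts {β : Base} {D' : Des} (isD' : IsDesign β D') where

  open IsDesign isD'

  -- If d·✠ ∈ D' with d ending negatively, then the only chronicle of D'
  -- strictly extending d is d·✠: a further ✠ must be last, a negative
  -- action would break alternation, and a positive one coherence.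
  daimonEndsBranch : ∀ {d z rest} → EndsNeg d → D' (d ∷ʳ daimon) →
                     D' (d ++ z ∷ rest) → d ++ z ∷ rest ≡ d ∷ʳ daimon
  daimonEndsBranch {d} {daimon} {rest} _ _ Dy =
    cong (λ r → d ++ daimon ∷ r) (IsChronicle.daimonLast (chronicles _ Dy) d rest refl)
  daimonEndsBranch {z = act neg σ J} {rest} (p , ξ , I , refl) _ Dy
    with IsChronicle.alternating (chronicles _ Dy) p (act neg ξ I) (act neg σ J) rest
           (++-assoc p (act neg ξ I ∷ []) (act neg σ J ∷ rest))
  ... | ()
  daimonEndsBranch {d} {act pos σ J} {rest} _ Dd Dy =
    ⊥-elim (positiveDivergenceIncoherent d daimon (act pos σ J) [] rest refl refl (λ ())
              (coherent _ _ Dd Dy))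

  Reached : Pol → Chron → Set
  Reached q c = c ≡ [] ⊎ (D' c × ∃ λ p → ∃ λ ξ → ∃ λ I → c ≡ p ∷ʳ act q ξ I)

  reachedNotBeyondDaimon : ∀ {q x d z rest} → Reached q x → x ≡ d ++ z ∷ rest →
                           EndsNeg d → D' (d ∷ʳ daimon) → ⊥
  reachedNotBeyondDaimon {d = d} {z} {rest} (inj₁ refl) x≡ _ _
    with ++-conicalʳ d (z ∷ rest) (sym x≡)
  ... | ()
  reachedNotBeyondDaimon {d = d} (inj₂ (Dx , p , ξ , I , refl)) x≡ en Dd
    with ∷ʳ-injectiveʳ p d (trans x≡ (daimonEndsBranch en Dd (subst D' x≡ Dx)))
  ... | ()

  shortenAtReached : ∀ {q x a s} → Reached q x → D' s → IsShorten (x ∷ʳ a) s →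
                     s ≡ x ∷ʳ a ⊎ (EndsNeg (x ∷ʳ a) × s ≡ x ∷ʳ a ∷ʳ daimon)
                                ⊎ (EndsNeg x × s ≡ x ∷ʳ daimon)
  shortenAtReached _ _ (inj₁ s≡) = inj₁ s≡
  shortenAtReached {x = x} {a} reached Ds (inj₂ (d , e , eq , en , refl))
    with prefixOfSnoc x a d e eq
  ... | inj₁ refl = inj₂ (inj₁ (en , refl))
  ... | inj₂ (inj₁ refl) = inj₂ (inj₂ (en , refl))
  ... | inj₂ (inj₂ (_ , _ , x≡)) = ⊥-elim (reachedNotBeyondDaimon reached x≡ en Ds)

splitPointwise : ∀ {a b ℓ} {A : Set a} {B : Set b} {R : REL A B ℓ}
                 (xs : List A) {x ys zs} → Pointwise R (xs ++ x ∷ ys) zs →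
                 Σ (List B) λ xs' → Σ B λ x' → Σ (List B) λ ys' →
                 (zs ≡ xs' ++ x' ∷ ys') × Pointwise R xs xs' × R x x' × Pointwise R ys ys'
splitPointwise []       (r ∷ rs) = [] , _ , _ , refl , [] , r , rs
splitPointwise (_ ∷ xs) (r ∷ rs) with splitPointwise xs rs
... | xs' , x' , ys' , refl , rxs , rx , rys = _ ∷ xs' , x' , ys' , refl , r ∷ rxs , rx , rys

module Replay {β : Base} (D D' : Des) (isD' : IsDesign β D')
              (represented : ∀ c → D c → ∃ λ s → IsShorten c s × D' s) where

  open IsDesign isD'
  open DesignFacts isD'

  followPositive : ∀ {c a} → Reached neg c → D (c ∷ʳ a) → pol a ≡ pos →
                   D' (c ∷ʳ a) ⊎ D' (c ∷ʳ daimon)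
  followPositive {c} {a} reached Dca pa with represented (c ∷ʳ a) Dca
  ... | s , sh , Ds with shortenAtReached reached Ds sh
  ... | inj₁ refl = inj₁ Ds
  ... | inj₂ (inj₂ (_ , refl)) = inj₂ Ds
  ... | inj₂ (inj₁ (en , _)) with trans (sym pa) (endsNegLast c a en)
  ...   | ()

  followNegative : ∀ {p τ J} → Reached pos p → D (p ∷ʳ act neg τ J) → D' (p ∷ʳ act neg τ J)
  followNegative {p} {τ} {J} reached Dp with represented (p ∷ʳ act neg τ J) Dp
  ... | s , sh , Ds with shortenAtReached reached Ds sh
  ... | inj₁ refl = Ds
  ... | inj₂ (inj₁ (_ , refl)) =
    prefClosed (p ∷ʳ act neg τ J) (daimon ∷ []) Ds (snoc≢[] p (act neg τ J))
  ... | inj₂ (inj₂ ((q , ξ , I , e) , refl)) with reached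
  ...   | inj₁ refl = ⊥-elim (snoc≢[] q (act neg ξ I) (sym e))
  ...   | inj₂ (_ , q' , σ , I' , refl) with ∷ʳ-injectiveʳ q' q e
  ...     | ()

  data HandleSim : Handle → Handle → Set₁ where
    sameHandle      : ∀ {h} → HandleSim h h
    shortenedHandle : ∀ {σ p} → Reached pos p → HandleSim (handle σ D p) (handle σ D' p)

  HandlesSim : List Handle → List Handle → Set₁
  HandlesSim = Pointwise HandleSim

  data PlayerSim : Des → Des → Chron → Set₁ where
    samePlayer      : ∀ {X c} → PlayerSim X X c
    shortenedPlayer : ∀ {c} → Reached neg c → PlayerSim D D' c

  replayStep : ∀ {H H' P P' c σ I R c' H₁ H₂} →
    P' (c ∷ʳ act pos σ I) →
    H ≡ H₁ ++ handle σ R c' ∷ H₂ →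
    R (c' ∷ʳ act neg σ I) →
    (∀ {τ} → HandleSim (handle τ P (c ∷ʳ act pos σ I)) (handle τ P' (c ∷ʳ act pos σ I))) →
    (∀ {K R'} → HandlesSim (H₁ ++ H₂ ++ map (λ i → handle (σ ∷ʳ i) P (c ∷ʳ act pos σ I)) I) K →
       PlayerSim R R' (c' ∷ʳ act neg σ I) → Conv K R' (c' ∷ʳ act neg σ I)) →
    HandlesSim H H' → Conv H' P' c
  replayStep {I = I} {H₁ = H₁} played refl received children continue related
    with splitPointwise H₁ related
  ... | _ , _ , _ , refl , before , sameHandle , after =
    step played refl received
      (continue (++⁺ before (++⁺ after (map⁺ _ _ (Pointwise.refl children)))) samePlayer)
  ... | _ , _ , _ , refl , before , shortenedHandle {p = p} reached , after =
    step played refl (followNegative reached received)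
      (continue (++⁺ before (++⁺ after (map⁺ _ _ (Pointwise.refl children))))
                (shortenedPlayer (inj₂ (followNegative reached received , p , _ , I , refl))))

  replay : ∀ {H H' X X' c} → Conv H X c → HandlesSim H H' → PlayerSim X X' c → Conv H' X' c
  replay (dai x) _ samePlayer = dai x
  replay (dai x) _ (shortenedPlayer reached) with followPositive reached x refl
  ... | inj₁ y = dai y
  ... | inj₂ y = dai y
  replay (step x eq r run) related samePlayer =
    replayStep x eq r sameHandle (λ k p → replay run k p) related
  replay {c = c} (step {σ = σ} {I = I} x eq r run) related (shortenedPlayer reached)
    with followPositive reached x refl
  ... | inj₂ y = dai y
  ... | inj₁ y = replayStep y eq r (shortenedHandle (inj₂ (y , c , σ , I , refl)))
                   (λ k p → replay run k p) related

shorteningKeepsOrthogonal : (β : Base) (D D' : Des) → IsDesign β D' →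
  (∀ c → D c → ∃ λ s → IsShorten c s × D' s) →
  ∀ R → Orth β D R → Orth β D' R
shorteningKeepsOrthogonal (nothing ⊢ Δ) D D' isD' represented R orth =
  replay orth (Pointwise.refl sameHandle) (shortenedPlayer (inj₁ refl))
  where open Replay D D' isD' represented
shorteningKeepsOrthogonal (just ξ ⊢ Δ) D D' isD' represented R orth =
  replay orth (shortenedHandle (inj₁ refl) ∷ Pointwise.refl sameHandle) samePlayer
  where open Replay D D' isD' represented

mainTheorem7 : (β : Base) → IsBase β → (E : Des → Set) →
    (∀ D → E D → IsDesign β D) →
    ∀ D' → DaiShort β E D' → BiPerp β E D'
mainTheorem7 β _ E _ D' (isD' , D , D∈E , _ , represented) =
  isD' , λ R R∈E⊥ → shorteningKeepsOrthogonal β D D' isD' represented R (proj₂ R∈E⊥ D D∈E)
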